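{- Let $(G=(V,E),\ell,k)$ be an instance of \textsc{Colored Clustering}, let $M$ be a maximal matching of $G$ and $S:=\bigcup_{e\in M}e$. For $v\in V$ and color $c$, let $N_c(v)$ be the set of vertices joined to $v$ by an edge of color $c$. Let $T\subseteq S$ be the set of vertices $v\in S$ with $|\{c\in C : |N_c(v)\setminus S|\ge 2k^{1/2}\}|\ge 2k^{1/2}$. If $|T|\ge k^{1/2}$, then $G$ contains a stable edge set of size at least $k$.
   Context: \textsc{Colored Clustering}: given a graph $G=(V,E)$, an edge coloring $\ell\colon E\to C$, and $k\in\mathbb{N}$, decide whether there is a stable $F\subseteq E$ with $|F|\ge k$; $F$ is stable if $\ell(e)=\ell(e')$ whenever $e,e'\in F$ share a vertex. -}

module Defs where

open import Data.Nat using (ℕ; _≤_; _*_)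
open import Data.Fin using (Fin)
open import Data.Fin.Subset using (Subset; _∈_; _∉_; ⁅_⁆; _∪_; ∣_∣)
open import Data.Product using (Σ; ∃; _×_; _,_; proj₁; proj₂)
open import Data.Sum using (_⊎_)
open import Relation.Nullary using (¬_)
open import Relation.Binary.PropositionalEquality using (_≡_; _≢_)
open import Function.Definitions using (Injective)

record Graph : Set where
  field
    n    : ℕ
    m    : ℕ
    ends : Fin m → Fin n × Fin n
    loopless : ∀ e → proj₁ (ends e) ≢ proj₂ (ends e)
    simple   : ∀ e e' →
      (ends e ≡ ends e' ⊎ (proj₁ (ends e) ≡ proj₂ (ends e') × proj₂ (ends e) ≡ proj₁ (ends e'))) →
      e ≡ e'

module _ (G : Graph) where
  open Graph G

  Vertex : Set
  Vertex = Fin n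

  Edge : Set
  Edge = Fin m

  Incident : Vertex → Edge → Set
  Incident v e = v ≡ proj₁ (ends e) ⊎ v ≡ proj₂ (ends e)

  Share : Edge → Edge → Set
  Share e e' = ∃ λ v → Incident v e × Incident v e'

  Joins : Edge → Vertex → Vertex → Set
  Joins e u v = ends e ≡ (u , v) ⊎ ends e ≡ (v , u)

  Stable : {C : Set} → (Edge → C) → Subset m → Set
  Stable ℓ F = ∀ e e' → e ∈ F → e' ∈ F → Share e e' → ℓ e ≡ ℓ e'

  IsMatching : Subset m → Set
  IsMatching M = ∀ e e' → e ∈ M → e' ∈ M → Share e e' → e ≡ e'

  IsMaximalMatching : Subset m → Set
  IsMaximalMatching M = IsMatching M × (∀ e → e ∉ M → ¬ IsMatching (⁅ e ⁆ ∪ M))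

  Covered : Subset m → Vertex → Set
  Covered M v = ∃ λ e → e ∈ M × Incident v e

  NcMinusS : {C : Set} → (Edge → C) → Subset m → C → Vertex → Vertex → Set
  NcMinusS ℓ M c v u = (∃ λ e → ℓ e ≡ c × Joins e v u) × ¬ Covered M u

AtLeast : {A : Set} → ℕ → (A → Set) → Set
AtLeast {A} t P = Σ (Fin t → A) λ f → Injective _≡_ _≡_ f × (∀ i → P (f i))

-- |{x : P x}| ≥ 2·k^{1/2}  (equivalently: at least t elements with t² ≥ 4k)
AtLeastTwoSqrt : {A : Set} → ℕ → (A → Set) → Set
AtLeastTwoSqrt k P = ∃ λ t → 4 * k ≤ t * t × AtLeast t P

-- |{x : P x}| ≥ k^{1/2}  (equivalently: at least t elements with t² ≥ k)
AtLeastSqrt : {A : Set} → ℕ → (A → Set) → Set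
AtLeastSqrt k P = ∃ λ t → k ≤ t * t × AtLeast t P

module _ (G : Graph) where
  open Graph G

  InT : {C : Set} → (Edge G → C) → ℕ → Subset m → Vertex G → Set
  InT {C} ℓ k M v =
    Covered G M v × AtLeastTwoSqrt {C} k (λ c → AtLeastTwoSqrt k (NcMinusS G ℓ M c v))

-- Let a = ⌈√k⌉ and pick a vertices of T. Give them, one after another,
-- monochromatic stars of a edges whose leaves lie outside S and avoid the
-- fewer than a² leaves used so far. This is possible because a vertex of T
-- has a colours with at least 2a − 1 neighbours outside S each: every such
-- colour has either a unused or a used neighbours, and as G is simple the
-- neighbourhoods of distinct colours are disjoint, so if all a colours had
-- a used neighbours there would be a² used leaves. The a² star edges form a
-- stable set, since centres lie in S, leaves do not, and distinct stars
-- share neither centres nor leaves.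
module Submission where

open import Defs
open import Data.Nat using (ℕ; _≤_; zero; suc; pred; _+_; _*_; _<_; z≤n; s≤s; s≤s⁻¹; _≤?_)
open import Data.Fin.Subset using (Subset; ∣_∣; ⊥; ⁅_⁆; _∪_; _∈_; _-_)
open import Data.Product using (Σ; _×_; ∃; ∃₂; _,_; proj₁; proj₂; uncurry)
open import Data.Nat.Properties
  using (≤-refl; ≤-trans; <⇒≤; ≤-<-trans; <⇒≢; <⇒≱; ≰⇒>; m≤n⇒m≤1+n; m≤n+m; +-suc;
         +-mono-≤; +-monoʳ-<; *-mono-≤; *-monoˡ-<; *-monoʳ-<; module ≤-Reasoning)
open import Data.Nat.Tactic.RingSolver using (solve-∀)
open import Data.Fin using (Fin; zero; suc; inject≤; combine; remQuot)
open import Data.Fin.Properties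
  using (suc-injective; 0≢1+n; inject≤-injective; injective⇒≤; combine-remQuot;
         remQuot-combine; any?)
  renaming (_≟_ to _≟ᶠ_)
open import Data.Fin.Subset.Properties
  using (∉⊥; x∈⁅x⁆; x∈⁅y⁆⇒x≡y; x∈p∪q⁺; x∈p∪q⁻; x∈p∧x≢y⇒x∈p-y; x∈p⇒∣p-x∣<∣p∣)
open import Data.Sum using (_⊎_; inj₁; inj₂)
open import Data.Empty using (⊥-elim)
open import Function using (_∘_)
open import Function.Definitions using (Injective)
open import Level using (0ℓ)
open import Relation.Nullary using (¬_; yes; no; contradiction)
open import Relation.Unary using (Pred; Decidable; ∁; _∩_; _∖_)
open import Relation.Binary.Definitions using (DecidableEquality)
open import Relation.Binary.PropositionalEquality
  using (_≡_; _≢_; refl; sym; trans; cong; subst; module ≡-Reasoning)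

private
  variable
    A B : Set
    a n p q r s t : ℕ

AtLeast-map : {P : Pred A 0ℓ} {Q : Pred B 0ℓ} (f : A → B) → Injective _≡_ _≡_ f →
              (∀ {x} → P x → Q (f x)) → AtLeast t P → AtLeast t Q
AtLeast-map f f-inj P⇒Q (g , g-inj , Pg) = f ∘ g , g-inj ∘ f-inj , P⇒Q ∘ Pg

AtLeast-mono : {P Q : Pred A 0ℓ} → (∀ {x} → P x → Q x) → AtLeast t P → AtLeast t Q
AtLeast-mono = AtLeast-map (λ x → x) (λ eq → eq)

AtLeast-weaken : {P : Pred A 0ℓ} → s ≤ t → AtLeast t P → AtLeast s P
AtLeast-weaken {s = s} {t = t} s≤t (f , f-inj , Pf) =
  f ∘ shrink , inject≤-injective s≤t s≤t _ _ ∘ f-inj , Pf ∘ shrink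
  where
  shrink : Fin s → Fin t
  shrink i = inject≤ i s≤t

AtLeast-cons : {P : Pred (Fin (suc r)) 0ℓ} → P zero → AtLeast t (P ∘ suc) → AtLeast (suc t) P
AtLeast-cons {r = r} {t = t} {P = P} P0 (f , f-inj , Pf) = g , g-inj , Pg
  where
  g : Fin (suc t) → Fin (suc r)
  g zero    = zero
  g (suc i) = suc (f i)
  g-inj : Injective _≡_ _≡_ g
  g-inj {zero}  {zero}  _  = refl
  g-inj {suc i} {suc j} eq = cong suc (f-inj (suc-injective eq))
  Pg : ∀ i → P (g i)
  Pg zero    = P0
  Pg (suc i) = Pf i

partition : {Q : Pred (Fin r) 0ℓ} → Decidable Q →
            ∃₂ λ x y → x + y ≡ r × AtLeast x Q × AtLeast y (∁ Q)
partition {zero} {Q} Q? = 0 , 0 , refl , none {Q} , none {∁ Q}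
  where
  none : {P : Pred (Fin 0) 0ℓ} → AtLeast 0 P
  none = (λ ()) , (λ { {()} }) , λ ()
partition {suc r} {Q} Q? with partition (Q? ∘ suc) | Q? zero
... | x , y , x+y≡r , Qs , ¬Qs | yes Q0 =
  suc x , y , cong suc x+y≡r , AtLeast-cons {P = Q} Q0 Qs ,
  AtLeast-map {P = ∁ (Q ∘ suc)} {Q = ∁ Q} suc suc-injective (λ ¬Q → ¬Q) ¬Qs
... | x , y , x+y≡r , Qs , ¬Qs | no ¬Q0 =
  x , suc y , trans (+-suc x y) (cong suc x+y≡r) ,
  AtLeast-map {P = Q ∘ suc} {Q = Q} suc suc-injective (λ Q → Q) Qs , AtLeast-cons {P = ∁ Q} ¬Q0 ¬Qs

x+y≡pred[a+a]⇒a≤x⊎a≤y : ∀ a x y → x + y ≡ pred (a + a) → a ≤ x ⊎ a ≤ y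
x+y≡pred[a+a]⇒a≤x⊎a≤y zero    _ _ _ = inj₁ z≤n
x+y≡pred[a+a]⇒a≤x⊎a≤y (suc a) x y x+y≡ with suc a ≤? x | suc a ≤? y
... | yes 1+a≤x | _          = inj₁ 1+a≤x
... | no _      | yes 1+a≤y = inj₂ 1+a≤y
... | no 1+a≰x  | no 1+a≰y  = contradiction x+y≡ (<⇒≢ x+y<)
  where
  open ≤-Reasoning
  x+y< : x + y < a + suc a
  x+y< = begin-strict
    x + y  ≤⟨ +-mono-≤ (s≤s⁻¹ (≰⇒> 1+a≰x)) (s≤s⁻¹ (≰⇒> 1+a≰y)) ⟩
    a + a  <⟨ +-monoʳ-< a ≤-refl ⟩
    a + suc a ∎

AtLeast-∩ : {P R : Pred A 0ℓ} (w : AtLeast r P) → AtLeast t (R ∘ proj₁ w) → AtLeast t (P ∩ R)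
AtLeast-∩ {P = P} {R} (f , f-inj , Pf) = AtLeast-map {Q = P ∩ R} f f-inj (λ {i} Rfi → Pf i , Rfi)

AtLeast-split : {P Q : Pred A 0ℓ} → Decidable Q → AtLeast (pred (a + a)) P →
                AtLeast a (P ∩ Q) ⊎ AtLeast a (P ∖ Q)
AtLeast-split {a = a} {P} {Q} Q? P-large@(f , _) with partition {Q = Q ∘ f} (Q? ∘ f)
... | x , y , x+y≡ , Qs , ¬Qs with x+y≡pred[a+a]⇒a≤x⊎a≤y a x y x+y≡
...   | inj₁ a≤x = inj₁ (AtLeast-weaken {P = P ∩ Q} a≤x (AtLeast-∩ {P = P} {Q} P-large Qs))
...   | inj₂ a≤y = inj₂ (AtLeast-weaken {P = P ∖ Q} a≤y (AtLeast-∩ {P = P} {∁ Q} P-large ¬Qs))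

remQuot-injective : ∀ q {z z' : Fin (p * q)} → remQuot {p} q z ≡ remQuot q z' → z ≡ z'
remQuot-injective {p} q {z} {z'} eq = begin
  z                                  ≡⟨ sym (combine-remQuot {p} q z) ⟩
  uncurry combine (remQuot {p} q z)  ≡⟨ cong (uncurry combine) eq ⟩
  uncurry combine (remQuot {p} q z') ≡⟨ combine-remQuot {p} q z' ⟩
  z'                                 ∎
  where open ≡-Reasoning

AtLeast-⋃ : {P : Fin p → Pred A 0ℓ} → (∀ {i j x} → P i x → P j x → i ≡ j) →
            (∀ i → AtLeast q (P i)) → AtLeast (p * q) (λ x → ∃ λ i → P i x)
AtLeast-⋃ {p = p} {A = A} {q = q} {P = P} disjoint family = uncurry g ∘ remQuot {p} q , f-inj , Pf
  where
  g : Fin p → Fin q → A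
  g i = proj₁ (family i)
  Pg : ∀ i j → P i (g i j)
  Pg i = proj₂ (proj₂ (family i))
  g-inj : ∀ {i j i' j'} → g i j ≡ g i' j' → (i , j) ≡ (i' , j')
  g-inj {i} {j} {i'} {j'} eq with disjoint (Pg i j) (subst (P i') (sym eq) (Pg i' j'))
  ... | refl = cong (i ,_) (proj₁ (proj₂ (family i)) eq)
  f-inj : Injective _≡_ _≡_ (uncurry g ∘ remQuot {p} q)
  f-inj = remQuot-injective q ∘ g-inj
  Pf : ∀ z → ∃ λ i → P i (uncurry g (remQuot {p} q z))
  Pf z = proj₁ (remQuot {p} q z) , uncurry Pg (remQuot {p} q z)

Image : (Fin n → A) → Pred A 0ℓ
Image u x = ∃ λ i → u i ≡ x

Image? : DecidableEquality A → (u : Fin n → A) → Decidable (Image u)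
Image? _≟_ u x = any? (λ i → u i ≟ x)

AtLeast-Image⇒≤ : (u : Fin n → A) → AtLeast t (Image u) → t ≤ n
AtLeast-Image⇒≤ u (f , f-inj , f∈) = injective⇒≤ index-inj
  where
  index-inj : Injective _≡_ _≡_ (proj₁ ∘ f∈)
  index-inj {j} {j'} eq = f-inj (trans (sym (proj₂ (f∈ j))) (trans (cong u eq) (proj₂ (f∈ j'))))

∀⊎⇒∃⊎∀ : {P Q : Pred (Fin n) 0ℓ} → (∀ i → P i ⊎ Q i) → (∃ λ i → Q i) ⊎ (∀ i → P i)
∀⊎⇒∃⊎∀ {zero}  _    = inj₂ λ ()
∀⊎⇒∃⊎∀ {suc n} P⊎Q with P⊎Q zero | ∀⊎⇒∃⊎∀ (P⊎Q ∘ suc)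
... | inj₂ Q0 | _              = inj₁ (zero , Q0)
... | inj₁ _  | inj₁ (i , Qi)  = inj₁ (suc i , Qi)
... | inj₁ P0 | inj₂ P∘suc     = inj₂ λ { zero → P0 ; (suc i) → P∘suc i }

AtLeast-avoid : {P : B → Pred A 0ℓ} → DecidableEquality A →
                (∀ {b b' x} → P b x → P b' x → b ≡ b') →
                AtLeast a (λ b → AtLeast (pred (a + a)) (P b)) →
                (used : Fin n → A) → n < a * a → ∃ λ b → AtLeast a (P b ∖ Image used)
AtLeast-avoid {A = A} {a = a} {n = n} {P = P} _≟_ disjoint (bs , bs-inj , large) used n<a²
  with ∀⊎⇒∃⊎∀ (λ i → AtLeast-split {P = P (bs i)} (Image? _≟_ used) (large i))
... | inj₁ (i , fresh) = bs i , fresh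
... | inj₂ stale = contradiction a²≤n (<⇒≱ n<a²)
  where
  Stale : Fin a → Pred A 0ℓ
  Stale i = P (bs i) ∩ Image used
  a²≤n : a * a ≤ n
  a²≤n = AtLeast-Image⇒≤ used
           (AtLeast-mono {P = λ x → ∃ λ i → Stale i x} (λ (_ , _ , x∈) → x∈)
             (AtLeast-⋃ {P = Stale} (λ (Px , _) (P'x , _) → bs-inj (disjoint Px P'x)) stale))

imageSubset : ∀ {m} → (Fin t → Fin m) → Subset m
imageSubset {zero}  _ = ⊥
imageSubset {suc t} f = ⁅ f zero ⁆ ∪ imageSubset (f ∘ suc)

∈-imageSubset : ∀ {m} (f : Fin t → Fin m) i → f i ∈ imageSubset f
∈-imageSubset f zero    = x∈p∪q⁺ (inj₁ (x∈⁅x⁆ (f zero)))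
∈-imageSubset f (suc i) = x∈p∪q⁺ (inj₂ (∈-imageSubset (f ∘ suc) i))

∈-imageSubset⁻ : ∀ {m} (f : Fin t → Fin m) {x} → x ∈ imageSubset f → Image f x
∈-imageSubset⁻ {zero}  f x∈ = ⊥-elim (∉⊥ x∈)
∈-imageSubset⁻ {suc t} f x∈ with x∈p∪q⁻ ⁅ f zero ⁆ (imageSubset (f ∘ suc)) x∈
... | inj₁ x∈⁅f0⁆ = zero , sym (x∈⁅y⁆⇒x≡y (f zero) x∈⁅f0⁆)
... | inj₂ x∈rest with ∈-imageSubset⁻ (f ∘ suc) x∈rest
...   | i , fi≡x = suc i , fi≡x

AtLeast-∈⇒≤∣∣ : ∀ {m} {F : Subset m} → AtLeast t (_∈ F) → t ≤ ∣ F ∣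
AtLeast-∈⇒≤∣∣ {zero}  _                = z≤n
AtLeast-∈⇒≤∣∣ {suc t} (f , f-inj , f∈) =
  ≤-trans (s≤s (AtLeast-∈⇒≤∣∣ (f ∘ suc , suc-injective ∘ f-inj , rest∈)))
          (x∈p⇒∣p-x∣<∣p∣ (f∈ zero))
  where
  rest∈ : ∀ i → f (suc i) ∈ _ - f zero
  rest∈ i = x∈p∧x≢y⇒x∈p-y (f∈ (suc i)) (λ eq → 0≢1+n (sym (f-inj eq)))

AtLeast⇒Subset : ∀ {m} {P : Pred (Fin m) 0ℓ} → AtLeast t P →
                 Σ (Subset m) λ F → (∀ {x} → x ∈ F → P x) × t ≤ ∣ F ∣
AtLeast⇒Subset {P = P} (f , f-inj , Pf) =
  imageSubset f , F⊆P , AtLeast-∈⇒≤∣∣ (f , f-inj , ∈-imageSubset f)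
  where
  F⊆P : ∀ {x} → x ∈ imageSubset f → P x
  F⊆P x∈ with ∈-imageSubset⁻ f x∈
  ... | i , refl = Pf i

IsCeilSqrt : ℕ → ℕ → Set
IsCeilSqrt k a = k ≤ a * a × (∀ b → b < a → b * b < k)

ceilSqrt≤ : ∀ {k} t → k ≤ t * t → ∃ λ a → a ≤ t × IsCeilSqrt k a
ceilSqrt≤ zero    k≤0 = 0 , z≤n , k≤0 , λ _ ()
ceilSqrt≤ {k} (suc t) k≤ with k ≤? t * t
... | yes k≤t² with ceilSqrt≤ t k≤t²
...   | a , a≤t , √k = a , m≤n⇒m≤1+n a≤t , √k
ceilSqrt≤ {k} (suc t) k≤ | no k≰t² = suc t , ≤-refl , k≤ , below
  where
  below : ∀ b → b < suc t → b * b < k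
  below b b<1+t = ≤-<-trans (*-mono-≤ (s≤s⁻¹ b<1+t) (s≤s⁻¹ b<1+t)) (≰⇒> k≰t²)

square-double : ∀ a → (a + a) * (a + a) ≡ 4 * (a * a)
square-double = solve-∀

ceilSqrt-double≤ : ∀ {k a s} → IsCeilSqrt k a → 4 * k ≤ s * s → pred (a + a) ≤ s
ceilSqrt-double≤ {a = zero} _ _ = z≤n
ceilSqrt-double≤ {k} {suc a} {s} (_ , below) 4k≤s² with a + suc a ≤? s
... | yes 2a+1≤s = 2a+1≤s
... | no 2a+1≰s = contradiction 4k≤s² (<⇒≱ s²<4k)
  where
  open ≤-Reasoning
  s≤2a : s ≤ a + a
  s≤2a = s≤s⁻¹ (subst (s <_) (+-suc a a) (≰⇒> 2a+1≰s))
  s²<4k : s * s < 4 * k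
  s²<4k = begin-strict
    s * s              ≤⟨ *-mono-≤ s≤2a s≤2a ⟩
    (a + a) * (a + a)  ≡⟨ square-double a ⟩
    4 * (a * a)        <⟨ *-monoʳ-< 4 (below a ≤-refl) ⟩
    4 * k              ∎

AtLeastTwoSqrt⇒AtLeast : ∀ {k} {P : Pred A 0ℓ} → IsCeilSqrt k a →
                         AtLeastTwoSqrt k P → AtLeast (pred (a + a)) P
AtLeastTwoSqrt⇒AtLeast {P = P} √k (s , 4k≤s² , P-large) =
  AtLeast-weaken {P = P} (ceilSqrt-double≤ √k 4k≤s²) P-large

m<n⇒m*n<n*n : q < a → q * a < a * a
m<n⇒m*n<n*n {a = suc _} = *-monoˡ-< _

n≤pred[n+n] : ∀ n → n ≤ pred (n + n)
n≤pred[n+n] zero    = z≤n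
n≤pred[n+n] (suc n) = m≤n+m (suc n) n

module _ (G : Graph) where
  open Graph G using (ends; simple)

  Incident-Joins : ∀ {e v u w} → Joins G e v u → Incident G w e → w ≡ v ⊎ w ≡ u
  Incident-Joins (inj₁ p) (inj₁ q) = inj₁ (trans q (cong proj₁ p))
  Incident-Joins (inj₁ p) (inj₂ q) = inj₂ (trans q (cong proj₂ p))
  Incident-Joins (inj₂ p) (inj₁ q) = inj₂ (trans q (cong proj₁ p))
  Incident-Joins (inj₂ p) (inj₂ q) = inj₁ (trans q (cong proj₂ p))

  Joins-injective : ∀ {e v u u'} → Joins G e v u → Joins G e v u' → u ≡ u'
  Joins-injective {e} p q with ends e
  Joins-injective (inj₁ refl) (inj₁ refl) | _ = refl
  Joins-injective (inj₁ refl) (inj₂ refl) | _ = refl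
  Joins-injective (inj₂ refl) (inj₁ refl) | _ = refl
  Joins-injective (inj₂ refl) (inj₂ refl) | _ = refl

  ends-swapped : ∀ {e e' x y} → ends e ≡ (x , y) → ends e' ≡ (y , x) →
                 proj₁ (ends e) ≡ proj₂ (ends e') × proj₂ (ends e) ≡ proj₁ (ends e')
  ends-swapped p q = trans (cong proj₁ p) (sym (cong proj₂ q)) , trans (cong proj₂ p) (sym (cong proj₁ q))

  Joins-unique : ∀ {e e' v u} → Joins G e v u → Joins G e' v u → e ≡ e'
  Joins-unique {e} {e'} (inj₁ p) (inj₁ q) = simple e e' (inj₁ (trans p (sym q)))
  Joins-unique {e} {e'} (inj₂ p) (inj₂ q) = simple e e' (inj₁ (trans p (sym q)))
  Joins-unique {e} {e'} (inj₁ p) (inj₂ q) = simple e e' (inj₂ (ends-swapped p q))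
  Joins-unique {e} {e'} (inj₂ p) (inj₁ q) = simple e e' (inj₂ (ends-swapped p q))

module _ {C : Set} (G : Graph) (ℓ : Edge G → C) (M : Subset (Graph.m G)) where

  NcMinusS-colour-unique : ∀ {c c' v u} → NcMinusS G ℓ M c v u → NcMinusS G ℓ M c' v u → c ≡ c'
  NcMinusS-colour-unique ((e , ℓe≡c , e-joins) , _) ((e' , ℓe'≡c' , e'-joins) , _) =
    trans (sym ℓe≡c) (trans (cong ℓ (Joins-unique G e-joins e'-joins)) ℓe'≡c')

  record Star (a : ℕ) (v : Vertex G) : Set where
    field
      colour : C
      leaves : AtLeast a (NcMinusS G ℓ M colour v)

    leaf : Fin a → Vertex G
    leaf = proj₁ leaves

    leaf-injective : Injective _≡_ _≡_ leaf
    leaf-injective = proj₁ (proj₂ leaves)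

    spoke : ∀ j → ∃ λ e → ℓ e ≡ colour × Joins G e v (leaf j)
    spoke j = proj₁ (proj₂ (proj₂ leaves) j)

    leaf-uncovered : ∀ j → ¬ Covered G M (leaf j)
    leaf-uncovered j = proj₂ (proj₂ (proj₂ leaves) j)

  open Star

  LeafDisjoint : {centre : Fin q → Vertex G} → (∀ i → Star a (centre i)) → Set
  LeafDisjoint st = ∀ i i' j j' → leaf (st i) j ≡ leaf (st i') j' → i ≡ i'

  module _ {k} (√k : IsCeilSqrt k a) where

    rich-colours : ∀ {v} → InT G ℓ k M v →
                   AtLeast a (λ c → AtLeast (pred (a + a)) (NcMinusS G ℓ M c v))
    rich-colours {v} (_ , colours) =
      AtLeast-weaken {P = Rich} (n≤pred[n+n] a)
        (AtLeast-mono {P = TwoSqrt} (λ {c} → AtLeastTwoSqrt⇒AtLeast {P = NcMinusS G ℓ M c v} √k)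
          (AtLeastTwoSqrt⇒AtLeast {P = TwoSqrt} √k colours))
      where
      Rich TwoSqrt : Pred C 0ℓ
      Rich c = AtLeast (pred (a + a)) (NcMinusS G ℓ M c v)
      TwoSqrt c = AtLeastTwoSqrt k (NcMinusS G ℓ M c v)

    star-avoiding : ∀ {v} → InT G ℓ k M v → (used : Fin n → Vertex G) → n < a * a →
                    Σ (Star a v) λ st → ∀ j → ¬ Image used (leaf st j)
    star-avoiding {v = v} v∈T used n<a²
      with AtLeast-avoid {P = λ c → NcMinusS G ℓ M c v} _≟ᶠ_ NcMinusS-colour-unique
                         (rich-colours v∈T) used n<a²
    ... | c , fresh =
      record { colour = c ; leaves = AtLeast-mono {P = NcMinusS G ℓ M c v ∖ Image used} proj₁ fresh } ,
      proj₂ ∘ proj₂ (proj₂ fresh)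

    disjoint-stars : q ≤ a → (centre : Fin q → Vertex G) → (∀ i → InT G ℓ k M (centre i)) →
                     Σ (∀ i → Star a (centre i)) LeafDisjoint
    disjoint-stars {zero}  _    _      _      = (λ ()) , λ ()
    disjoint-stars {suc q} q<a centre centre∈T = st , disjoint
      where
      earlier : Σ (∀ i → Star a (centre (suc i))) LeafDisjoint
      earlier = disjoint-stars (<⇒≤ q<a) (centre ∘ suc) (centre∈T ∘ suc)
      used : Fin (q * a) → Vertex G
      used = uncurry (leaf ∘ proj₁ earlier) ∘ remQuot a
      used-combine : ∀ i j → used (combine i j) ≡ leaf (proj₁ earlier i) j
      used-combine i j = cong (uncurry (leaf ∘ proj₁ earlier)) (remQuot-combine i j)
      new : Σ (Star a (centre zero)) λ st → ∀ j → ¬ Image used (leaf st j)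
      new = star-avoiding (centre∈T zero) used (m<n⇒m*n<n*n q<a)
      st : ∀ i → Star a (centre i)
      st zero    = proj₁ new
      st (suc i) = proj₁ earlier i
      disjoint : LeafDisjoint st
      disjoint zero    zero     _ _  _  = refl
      disjoint zero    (suc i') j j' eq = ⊥-elim (proj₂ new j (combine i' j' , trans (used-combine i' j') (sym eq)))
      disjoint (suc i) zero     j j' eq = ⊥-elim (proj₂ new j' (combine i j , trans (used-combine i j) eq))
      disjoint (suc i) (suc i') j j' eq = cong suc (proj₂ earlier i i' j j' eq)

  module StarPacking {a} (centre : Fin a → Vertex G) (centre-inj : Injective _≡_ _≡_ centre)
                     (centre-covered : ∀ i → Covered G M (centre i)) (st : ∀ i → Star a (centre i))
                     (leaf-disjoint : LeafDisjoint st) where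

    StarEdge : Fin a → Pred (Edge G) 0ℓ
    StarEdge i e = ℓ e ≡ colour (st i) × ∃ λ j → Joins G e (centre i) (leaf (st i) j)

    star-edges : ∀ i → AtLeast a (StarEdge i)
    star-edges i = edge , edge-inj , λ j → proj₁ (proj₂ (spoke (st i) j)) , j , joins j
      where
      edge : Fin a → Edge G
      edge j = proj₁ (spoke (st i) j)
      joins : ∀ j → Joins G (edge j) (centre i) (leaf (st i) j)
      joins j = proj₂ (proj₂ (spoke (st i) j))
      edge-inj : Injective _≡_ _≡_ edge
      edge-inj {j} {j'} eq =
        leaf-injective (st i)
          (Joins-injective G (subst (λ e → Joins G e _ (leaf (st i) j)) eq (joins j)) (joins j'))

    centre≢leaf : ∀ i i' j → centre i ≢ leaf (st i') j
    centre≢leaf i i' j eq = leaf-uncovered (st i') j (subst (Covered G M) eq (centre-covered i))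

    same-star : ∀ {i i' e e'} → StarEdge i e → StarEdge i' e' → Share G e e' → i ≡ i'
    same-star (_ , _ , joins) (_ , _ , joins') (w , w∈e , w∈e')
      with Incident-Joins G joins w∈e | Incident-Joins G joins' w∈e'
    ... | inj₁ w≡c | inj₁ w≡c' = centre-inj (trans (sym w≡c) w≡c')
    ... | inj₁ w≡c | inj₂ w≡l' = ⊥-elim (centre≢leaf _ _ _ (trans (sym w≡c) w≡l'))
    ... | inj₂ w≡l | inj₁ w≡c' = ⊥-elim (centre≢leaf _ _ _ (trans (sym w≡c') w≡l))
    ... | inj₂ w≡l | inj₂ w≡l' = leaf-disjoint _ _ _ _ (trans (sym w≡l) w≡l')

    StarEdges : Pred (Edge G) 0ℓ
    StarEdges e = ∃ λ i → StarEdge i e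

    stable-star-edges : Σ (Subset (Graph.m G)) λ F → Stable G ℓ F × a * a ≤ ∣ F ∣
    stable-star-edges with AtLeast⇒Subset {P = StarEdges} (AtLeast-⋃ {P = StarEdge} disjoint star-edges)
      where
      disjoint : ∀ {i i' e} → StarEdge i e → StarEdge i' e → i ≡ i'
      disjoint {e = e} e∈i e∈i' = same-star e∈i e∈i' (proj₁ (Graph.ends G e) , inj₁ refl , inj₁ refl)
    ... | F , F⊆StarEdges , a²≤∣F∣ = F , stable , a²≤∣F∣
      where
      stable : Stable G ℓ F
      stable e e' e∈F e'∈F share with F⊆StarEdges e∈F | F⊆StarEdges e'∈F
      ... | i , e∈i@(ℓe≡ , _) | i' , e'∈i'@(ℓe'≡ , _) =
        trans ℓe≡ (trans (cong (colour ∘ st) (same-star e∈i e'∈i' share)) (sym ℓe'≡))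

lemma2 : (G : Graph) (C : Set) (ℓ : Edge G → C) (k : ℕ) (M : Subset (Graph.m G)) →
    IsMaximalMatching G M →
    AtLeastSqrt k (InT G ℓ k M) →
    Σ (Subset (Graph.m G)) (λ F → Stable G ℓ F × k ≤ ∣ F ∣)
lemma2 G C ℓ k M _ (t , k≤t² , T-large) with ceilSqrt≤ t k≤t²
... | a , a≤t , √k with AtLeast-weaken {P = InT G ℓ k M} a≤t T-large
... | centre , centre-inj , centre∈T with disjoint-stars G ℓ M √k ≤-refl centre centre∈T
... | st , leaf-disjoint
    with StarPacking.stable-star-edges G ℓ M centre centre-inj (proj₁ ∘ centre∈T) st leaf-disjoint
... | F , stable , a²≤∣F∣ = F , stable , ≤-trans (proj₁ √k) a²≤∣F∣
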